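{- Let $m\ge2$ and let $\mathcal{B}_U(m)$ be the homogeneous tree of degree $m+1$ with basin a single vertex $\mathcal{O}_0$. Let $v\ne\mathcal{O}_0$ be a vertex. Then the number $r(d,v)$ of vertices $x\in\mathcal{R}_{h(v)}$ that can be reached from $v$ by a path of length $d$ is $$r(d,v)=\begin{cases}0 & d \text{ odd},\\ m^{d/2} & d \text{ even},\ d<2h(v),\\ (m+1)m^{h(v)-1} & d\text{ even},\ d\ge 2h(v).\end{cases}$$
   Context: For a tree with basin $\mathcal{P}$ (a connected subcomplex): $\mathcal{P}_0=\mathcal{P}$, $\mathcal{P}_n=\{x: d(x,\mathcal{P}_{n-1})\le1\}$, $\mathcal{R}_0=\mathcal{P}$, $\mathcal{R}_n=\mathcal{P}_n\setminus\mathcal{P}_{n-1}$, and $h(v)$ is the unique $n$ with $v\in\mathcal{R}_n$. A path of length $d$ is a walk of $d$ edges, possibly backtracking. -}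

module Defs where

open import Data.Nat using (ℕ; zero; suc; _≤_)
open import Data.Fin using (Fin)
open import Data.List using (List; []; _∷_; length)
open import Data.List.Membership.Propositional using (_∈_)
open import Data.List.Relation.Unary.Unique.Propositional using (Unique)
open import Data.Product using (Σ; ∃; _×_)
open import Function.Bundles using (_⇔_)
open import Relation.Nullary using (¬_)
open import Relation.Binary.PropositionalEquality using (_≡_)

-- Concrete model of the homogeneous tree B_U(m) of degree m+1.
-- Vertices: the root O₀, and nodes  node i js  where i : Fin (m+1) is the
-- first step from the root and js : List (Fin m) are the subsequent steps
-- (most recent step at the head).
data V (m : ℕ) : Set where
  root : V m
  node : Fin (suc m) → List (Fin m) → V m

data Adj {m : ℕ} : V m → V m → Set where
  root-down : (i : Fin (suc m)) → Adj root (node i [])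
  root-up   : (i : Fin (suc m)) → Adj (node i []) root
  down : (i : Fin (suc m)) (j : Fin m) (js : List (Fin m)) →
         Adj (node i js) (node i (j ∷ js))
  up   : (i : Fin (suc m)) (j : Fin m) (js : List (Fin m)) →
         Adj (node i (j ∷ js)) (node i js)

-- Paths of length d: walks of d edges, backtracking allowed.
data Path {m : ℕ} : ℕ → V m → V m → Set where
  stay : (x : V m) → Path zero x x
  step : {d : ℕ} {x y z : V m} → Adj x y → Path d y z → Path (suc d) x z

InP : {m : ℕ} → ℕ → V m → Set
InP {m} n x = Σ ℕ λ k → k ≤ n × Path k (root {m}) x

InR : {m : ℕ} → ℕ → V m → Set
InR zero    x = InP zero x
InR (suc n) x = InP (suc n) x × ¬ InP n x

HasCount : {m : ℕ} → (V m → Set) → ℕ → Set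
HasCount {m} P k =
  Σ (List (V m)) λ xs → Unique xs × (∀ x → (x ∈ xs) ⇔ P x) × length xs ≡ k

ReachIn : {m : ℕ} → ℕ → ℕ → V m → V m → Set
ReachIn n d v x = InR n x × Path d v x

-- Let parent be the map towards the root (with parent root = root) and ancestor k its k-th
-- iterate.  Tracking how a walk climbs and descends shows that two vertices of the same depth
-- are joined by a walk of length d iff d = 2k and their k-th ancestors agree.  The vertices of
-- depth h sharing the k-th ancestor a of v are therefore the depth-k descendants of a,
-- m ^ k of them, when k < h; when k ≥ h every ancestor is the root and they form the whole
-- level h, of size (m + 1) m ^ (h - 1).
module Submission where

open import Defs
open import Data.Nat using (ℕ; zero; suc; _+_; _*_; _∸_; _^_; _≤_; _<_; z≤n)
open import Data.Nat.Properties
open import Data.Nat.GeneralisedArithmetic using (iterate)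
open import Data.Nat.Tactic.RingSolver using (solve-∀)
open import Data.Fin using (Fin)
import Data.Fin as Fin
open import Data.List using (List; []; _∷_; [_]; length; map; _++_; cartesianProductWith; allFin)
open import Data.List.Properties using (∷-injective; length-map; length-++; length-tabulate; ++-cancelʳ)
open import Data.List.Membership.Propositional using (_∈_)
open import Data.List.Membership.Propositional.Properties
  using (∈-allFin; ∈-map⁺; ∈-map⁻; ∈-cartesianProductWith⁺; ∈-cartesianProductWith⁻)
open import Data.List.Relation.Unary.Any using (here)
open import Data.List.Relation.Unary.Unique.Propositional using (Unique)
open import Data.List.Relation.Unary.Unique.Propositional.Properties
  using (map⁺; cartesianProductWith⁺; allFin⁺)
import Data.List.Relation.Unary.All as All
import Data.List.Relation.Unary.AllPairs as AllPairs
open import Data.Product using (∃; _×_; _,_; proj₁; proj₂)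
open import Data.Sum using (_⊎_; inj₁; inj₂)
open import Data.Empty using (⊥-elim)
open import Function.Bundles using (_⇔_; mk⇔; Equivalence)
open import Function.Properties.Equivalence using () renaming (trans to ⇔-trans)
open import Relation.Nullary using (¬_)
open import Relation.Binary.PropositionalEquality
  using (_≡_; _≢_; refl; sym; trans; cong; cong₂; subst; module ≡-Reasoning)

open ≡-Reasoning

iterate-suc : ∀ {A : Set} (f : A → A) x n → iterate f x (suc n) ≡ f (iterate f x n)
iterate-suc f x zero    = refl
iterate-suc f x (suc n) = iterate-suc f (f x) n

iterate-+ : ∀ {A : Set} (f : A → A) x m n → iterate f x (m + n) ≡ iterate f (iterate f x m) n
iterate-+ f x zero    n = refl
iterate-+ f x (suc m) n = iterate-+ f (f x) m n

length-cartesianProductWith : ∀ {A B C : Set} (f : A → B → C) xs ys →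
  length (cartesianProductWith f xs ys) ≡ length xs * length ys
length-cartesianProductWith f []       ys = refl
length-cartesianProductWith f (x ∷ xs) ys = begin
  length (map (f x) ys ++ cartesianProductWith f xs ys)
    ≡⟨ length-++ (map (f x) ys) ⟩
  length (map (f x) ys) + length (cartesianProductWith f xs ys)
    ≡⟨ cong₂ _+_ (length-map (f x) ys) (length-cartesianProductWith f xs ys) ⟩
  length ys + length xs * length ys ∎

allLists : (n k : ℕ) → List (List (Fin n))
allLists n zero    = [ [] ]
allLists n (suc k) = cartesianProductWith _∷_ (allFin n) (allLists n k)

module _ {n : ℕ} where

  allLists-unique : ∀ k → Unique (allLists n k)
  allLists-unique zero    = All.[] AllPairs.∷ AllPairs.[]
  allLists-unique (suc k) = cartesianProductWith⁺ _∷_ ∷-injective (allFin⁺ n) (allLists-unique k)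

  ∈-allLists⁺ : ∀ (ys : List (Fin n)) → ys ∈ allLists n (length ys)
  ∈-allLists⁺ []       = here refl
  ∈-allLists⁺ (y ∷ ys) = ∈-cartesianProductWith⁺ _∷_ (∈-allFin y) (∈-allLists⁺ ys)

  ∈-allLists⁻ : ∀ k {ys} → ys ∈ allLists n k → length ys ≡ k
  ∈-allLists⁻ zero    (here refl) = refl
  ∈-allLists⁻ (suc k) ys∈ with ∈-cartesianProductWith⁻ _∷_ (allFin n) (allLists n k) ys∈
  ... | _ , zs , _ , zs∈ , refl = cong suc (∈-allLists⁻ k zs∈)

  length-allLists : ∀ k → length (allLists n k) ≡ n ^ k
  length-allLists zero    = refl
  length-allLists (suc k) = begin
    length (cartesianProductWith _∷_ (allFin n) (allLists n k))
      ≡⟨ length-cartesianProductWith _∷_ (allFin n) (allLists n k) ⟩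
    length (allFin n) * length (allLists n k)
      ≡⟨ cong₂ _*_ (length-tabulate {n = n} (λ i → i)) (length-allLists k) ⟩
    n * n ^ k ∎

module _ {m : ℕ} where

  HasCount-cong : {P Q : V m → Set} {c : ℕ} → (∀ x → P x ⇔ Q x) → HasCount P c → HasCount Q c
  HasCount-cong P⇔Q (xs , unique , ∈⇔P , len) = xs , unique , (λ x → ⇔-trans (∈⇔P x) (P⇔Q x)) , len

  HasCount-none : {P : V m → Set} → (∀ x → ¬ P x) → HasCount P 0
  HasCount-none ¬P = [] , AllPairs.[] , (λ x → mk⇔ (λ ()) (λ p → ⊥-elim (¬P x p))) , refl

  depth : V m → ℕ
  depth root        = 0
  depth (node _ js) = suc (length js)

  parent : V m → V m
  parent root               = root
  parent (node _ [])        = root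
  parent (node i (_ ∷ js)) = node i js

  ancestor : ℕ → V m → V m
  ancestor k x = iterate parent x k

  node-injective : ∀ {i i′ js js′} → node {m} i js ≡ node i′ js′ → i ≡ i′ × js ≡ js′
  node-injective refl = refl , refl

  depth≡0⇒root : ∀ {x} → depth x ≡ 0 → x ≡ root
  depth≡0⇒root {root} _ = refl

  depth-parent : ∀ x → depth (parent x) ≡ depth x ∸ 1
  depth-parent root             = refl
  depth-parent (node _ [])      = refl
  depth-parent (node _ (_ ∷ _)) = refl

  depth-ancestor : ∀ k x → depth (ancestor k x) ≡ depth x ∸ k
  depth-ancestor zero    x = refl
  depth-ancestor (suc k) x = begin
    depth (ancestor k (parent x)) ≡⟨ depth-ancestor k (parent x) ⟩
    depth (parent x) ∸ k          ≡⟨ cong (_∸ k) (depth-parent x) ⟩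
    depth x ∸ 1 ∸ k               ≡⟨ ∸-+-assoc (depth x) 1 k ⟩
    depth x ∸ suc k               ∎

  ancestor≡root : ∀ {k x} → depth x ≤ k → ancestor k x ≡ root
  ancestor≡root {k} {x} dx≤k = depth≡0⇒root (trans (depth-ancestor k x) (m≤n⇒m∸n≡0 dx≤k))

  ancestor-prefix : ∀ i ys ws → ancestor (length ys) (node i (ys ++ ws)) ≡ node i ws
  ancestor-prefix i []       ws = refl
  ancestor-prefix i (_ ∷ ys) ws = ancestor-prefix i ys ws

  ancestor≡node⇒prefix : ∀ k {x i ws} → ancestor k x ≡ node i ws → depth x ≡ suc (length ws) + k →
    ∃ λ ys → length ys ≡ k × x ≡ node i (ys ++ ws)
  ancestor≡node⇒prefix zero    x≡a _ = [] , refl , x≡a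
  ancestor≡node⇒prefix (suc k) {root} _ ()
  ancestor≡node⇒prefix (suc k) {node _ []} a≡node _
    with trans (sym (ancestor≡root {k} {root} z≤n)) a≡node
  ... | ()
  ancestor≡node⇒prefix (suc k) {node _ (j ∷ js)} {ws = ws} a≡node dx
    with ancestor≡node⇒prefix k a≡node (suc-injective (trans dx (+-suc (suc (length ws)) k)))
  ... | ys , refl , refl = j ∷ ys , refl , refl

  ParentOf : V m → V m → Set
  ParentOf y x = parent x ≡ y × depth x ≡ suc (depth y)

  adj⇒parent : ∀ {x y} → Adj x y → ParentOf y x ⊎ ParentOf x y
  adj⇒parent (root-down _) = inj₂ (refl , refl)
  adj⇒parent (root-up _)   = inj₁ (refl , refl)
  adj⇒parent (down _ _ _)  = inj₂ (refl , refl)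
  adj⇒parent (up _ _ _)    = inj₁ (refl , refl)

  adj-parent : ∀ i js → Adj (node i js) (parent (node i js))
  adj-parent i []       = root-up i
  adj-parent i (j ∷ js) = up i j js

  adj-child : ∀ i js → Adj (parent (node i js)) (node {m} i js)
  adj-child i []       = root-down i
  adj-child i (j ∷ js) = down i j js

  snoc : ∀ {d} {x y z : V m} → Path d x y → Adj y z → Path (suc d) x z
  snoc (stay _)   y~z = step y~z (stay _)
  snoc (step a p) y~z = step a (snoc p y~z)

  path-from-root : ∀ x → Path (depth x) root x
  path-from-root root              = stay root
  path-from-root (node i [])       = step (root-down i) (stay _)
  path-from-root (node i (j ∷ js)) = snoc (path-from-root (node i js)) (down i j js)

  bounce-root : ∀ k → Path (2 * k) root root
  bounce-root zero    = stay root
  bounce-root (suc k) = subst (λ d → Path {m} d root root) (sym (*-suc 2 k))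
    (step (root-down Fin.zero) (step (root-up Fin.zero) (bounce-root k)))

  -- A walk of length d from v to x: u steps up from v and w steps up from x reach a common
  -- vertex, and the remaining 2e steps are back-and-forth detours.
  record Meet (d : ℕ) (v x : V m) : Set where
    constructor meet
    field
      u w e       : ℕ
      length-eq   : d ≡ u + w + 2 * e
      depth-eq    : depth v + w ≡ depth x + u
      ancestor-eq : ancestor u v ≡ ancestor w x

  path⇒meet : ∀ {d v x} → Path d v x → Meet d v x
  path⇒meet (stay x) = meet 0 0 0 refl refl refl
  path⇒meet (step v~y p) with adj⇒parent v~y | path⇒meet p
  ... | inj₁ (refl , dv) | meet u w e len dep anc =
    meet (suc u) w e (cong suc len) (trans (cong (_+ w) dv) (trans (cong suc dep) (sym (+-suc _ u)))) anc
  ... | inj₂ (refl , dy) | meet zero w e len dep anc =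
    meet 0 (suc w) e (cong suc len)
      (trans (+-suc _ w) (trans (cong (_+ w) (sym dy)) dep))
      (trans (cong parent anc) (sym (iterate-suc parent _ w)))
  ... | inj₂ (refl , dy) | meet (suc u) w e len dep anc =
    meet u w (suc e) (trans (cong suc len) (detour u w e))
      (suc-injective (trans (cong (_+ w) (sym dy)) (trans dep (+-suc _ u)))) anc
    where
    detour : ∀ u w e → suc (suc u + w + 2 * e) ≡ u + w + 2 * suc e
    detour = solve-∀

  path⇒sameAncestor : ∀ {d v x} → depth v ≡ depth x → Path d v x →
    ∃ λ k → d ≡ 2 * k × ancestor k v ≡ ancestor k x
  path⇒sameAncestor {v = v} {x} dv≡dx p with path⇒meet p
  ... | meet u w e len dep anc with +-cancelˡ-≡ (depth v) w u (trans dep (cong (_+ u) (sym dv≡dx)))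
  ... | refl = u + e , trans len (double u e) , (begin
    ancestor (u + e) v        ≡⟨ iterate-+ parent v u e ⟩
    ancestor e (ancestor u v) ≡⟨ cong (ancestor e) anc ⟩
    ancestor e (ancestor u x) ≡⟨ sym (iterate-+ parent x u e) ⟩
    ancestor (u + e) x        ∎)
    where
    double : ∀ u e → u + u + 2 * e ≡ 2 * (u + e)
    double = solve-∀

  sameAncestor⇒path : ∀ k {v x} → depth v ≡ depth x → ancestor k v ≡ ancestor k x → Path (2 * k) v x
  sameAncestor⇒path k       {root}      {root}      _  _   = bounce-root k
  sameAncestor⇒path k       {root}      {node _ _}  ()
  sameAncestor⇒path k       {node _ _}  {root}      ()
  sameAncestor⇒path zero    {node _ _}  {node _ _}  _  refl = stay _
  sameAncestor⇒path (suc k) {node i js} {node i′ js′} dv≡dx anc =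
    subst (λ d → Path d (node i js) (node i′ js′)) (sym (*-suc 2 k))
      (step (adj-parent i js) (snoc (sameAncestor⇒path k parents-same-depth anc) (adj-child i′ js′)))
    where
    parents-same-depth : depth (parent (node i js)) ≡ depth (parent (node i′ js′))
    parents-same-depth = trans (depth-parent (node i js))
      (trans (cong (_∸ 1) dv≡dx) (sym (depth-parent (node i′ js′))))

  depth≤length-from-root : ∀ {d x} → Path d root x → depth x ≤ d
  depth≤length-from-root {x = x} p with path⇒meet p
  ... | meet u w e refl dep _ = ≤-trans (m≤m+n (depth x) u) (≤-trans (≤-reflexive (sym dep))
    (≤-trans (m≤n+m w u) (m≤m+n (u + w) (2 * e))))

  InP⇔depth≤ : ∀ {n x} → InP n x ⇔ depth x ≤ n
  InP⇔depth≤ {x = x} = mk⇔ (λ (_ , k≤n , p) → ≤-trans (depth≤length-from-root p) k≤n)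
                            (λ dx≤n → depth x , dx≤n , path-from-root x)

  InR⇔depth≡ : ∀ {h x} → InR h x ⇔ depth x ≡ h
  InR⇔depth≡ {zero}  = mk⇔ (λ x∈P → n≤0⇒n≡0 (Equivalence.to InP⇔depth≤ x∈P))
                           (λ dx≡0 → Equivalence.from InP⇔depth≤ (≤-reflexive dx≡0))
  InR⇔depth≡ {suc h} = mk⇔
    (λ (x∈P , x∉P) → ≤-antisym (Equivalence.to InP⇔depth≤ x∈P)
                               (≰⇒> (λ dx≤h → x∉P (Equivalence.from InP⇔depth≤ dx≤h))))
    (λ dx≡ → Equivalence.from InP⇔depth≤ (≤-reflexive dx≡) ,
             λ x∈P → 1+n≰n (subst (_≤ h) dx≡ (Equivalence.to InP⇔depth≤ x∈P)))

  ShareAncestor : ℕ → V m → V m → Set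
  ShareAncestor k v x = depth x ≡ depth v × ancestor k x ≡ ancestor k v

  ShareAncestor⇔ReachIn : ∀ k v x → ShareAncestor k v x ⇔ ReachIn (depth v) (2 * k) v x
  ShareAncestor⇔ReachIn k v x = mk⇔ to from
    where
    to : ShareAncestor k v x → ReachIn (depth v) (2 * k) v x
    to (dx≡dv , anc) = Equivalence.from InR⇔depth≡ dx≡dv , sameAncestor⇒path k (sym dx≡dv) (sym anc)
    from : ReachIn (depth v) (2 * k) v x → ShareAncestor k v x
    from (x∈R , p) with Equivalence.to InR⇔depth≡ x∈R
    ... | dx≡dv with path⇒sameAncestor (sym dx≡dv) p
    ... | k′ , 2k≡2k′ , anc with *-cancelˡ-≡ k k′ 2 2k≡2k′
    ... | refl = dx≡dv , sym anc

  no-odd-path : ∀ {k v x} → depth v ≡ depth x → ¬ Path (1 + 2 * k) v x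
  no-odd-path {k} dv≡dx p with path⇒sameAncestor dv≡dx p
  ... | k′ , odd≡even , _ = even≢odd k′ k (sym odd≡even)

  count-descendants : ∀ {a h} k → a ≢ root → depth a + k ≡ h →
    HasCount (λ x → depth x ≡ h × ancestor k x ≡ a) (m ^ k)
  count-descendants {root}      k a≢root _    = ⊥-elim (a≢root refl)
  count-descendants {node i ws} k _      refl =
    map extend (allLists m k) , map⁺ extend-injective (allLists-unique k) , (λ x → mk⇔ to from) ,
    trans (length-map extend (allLists m k)) (length-allLists k)
    where
    extend : List (Fin m) → V m
    extend ys = node i (ys ++ ws)
    extend-injective : ∀ {ys zs} → extend ys ≡ extend zs → ys ≡ zs
    extend-injective eq = ++-cancelʳ ws _ _ (proj₂ (node-injective eq))
    to : ∀ {x} → x ∈ map extend (allLists m k) → depth x ≡ suc (length ws) + k × ancestor k x ≡ node i ws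
    to x∈ with ∈-map⁻ extend x∈
    ... | ys , ys∈ , refl with ∈-allLists⁻ k ys∈
    ... | refl = cong suc (trans (length-++ ys) (+-comm (length ys) (length ws))) , ancestor-prefix i ys ws
    from : ∀ {x} → depth x ≡ suc (length ws) + k × ancestor k x ≡ node i ws → x ∈ map extend (allLists m k)
    from (dx , anc) with ancestor≡node⇒prefix k anc dx
    ... | ys , refl , refl = ∈-map⁺ extend (∈-allLists⁺ ys)

  count-level : ∀ n → HasCount (λ x → depth x ≡ suc n) (suc m * m ^ n)
  count-level n =
    xs , cartesianProductWith⁺ node node-injective (allFin⁺ (suc m)) (allLists-unique n) ,
    (λ x → mk⇔ to from) ,
    trans (length-cartesianProductWith node (allFin (suc m)) (allLists m n))
          (cong₂ _*_ (length-tabulate {n = suc m} (λ i → i)) (length-allLists n))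
    where
    xs : List (V m)
    xs = cartesianProductWith node (allFin (suc m)) (allLists m n)
    to : ∀ {x} → x ∈ xs → depth x ≡ suc n
    to x∈ with ∈-cartesianProductWith⁻ node (allFin (suc m)) (allLists m n) x∈
    ... | _ , js , _ , js∈ , refl = cong suc (∈-allLists⁻ n js∈)
    from : ∀ {x} → depth x ≡ suc n → x ∈ xs
    from {node i js} refl = ∈-cartesianProductWith⁺ node (∈-allFin i) (∈-allLists⁺ js)

  count-ShareAncestor-< : ∀ {k v} → k < depth v → HasCount (ShareAncestor k v) (m ^ k)
  count-ShareAncestor-< {k} {v} k<dv = count-descendants k ancestor≢root (begin
    depth (ancestor k v) + k ≡⟨ cong (_+ k) (depth-ancestor k v) ⟩
    depth v ∸ k + k          ≡⟨ m∸n+n≡m (<⇒≤ k<dv) ⟩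
    depth v                  ∎)
    where
    ancestor≢root : ancestor k v ≢ root
    ancestor≢root a≡root =
      <⇒≢ (m<n⇒0<n∸m k<dv) (sym (trans (sym (depth-ancestor k v)) (cong depth a≡root)))

  count-ShareAncestor-≥ : ∀ {k} i js → depth (node i js) ≤ k →
    HasCount (ShareAncestor k (node i js)) (suc m * m ^ length js)
  count-ShareAncestor-≥ i js dv≤k = HasCount-cong
    (λ x → mk⇔ (λ dx≡dv → dx≡dv , trans (ancestor≡root (≤-trans (≤-reflexive dx≡dv) dv≤k))
                                         (sym (ancestor≡root dv≤k)))
               proj₁)
    (count-level (length js))

proposition3p4 : (m : ℕ) → 2 ≤ m → (v : V m) → ¬ (v ≡ root) →
    (h : ℕ) → InR h v → (d : ℕ) →
    ((∃ λ k → d ≡ 1 + 2 * k) → HasCount (ReachIn h d v) 0)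
    × ((k : ℕ) → d ≡ 2 * k → k < h → HasCount (ReachIn h d v) (m ^ k))
    × ((k : ℕ) → d ≡ 2 * k → h ≤ k →
         HasCount (ReachIn h d v) ((m + 1) * m ^ (h ∸ 1)))
proposition3p4 m _ root v≢root _ _ _ = ⊥-elim (v≢root refl)
proposition3p4 m _ v@(node i js) _ h v∈R d with Equivalence.to InR⇔depth≡ v∈R
... | refl = odd , even-short , even-long
  where
  odd : (∃ λ k → d ≡ 1 + 2 * k) → HasCount (ReachIn h d v) 0
  odd (k , refl) = HasCount-none λ x (x∈R , p) → no-odd-path {k = k} (sym (Equivalence.to InR⇔depth≡ x∈R)) p
  even-short : ∀ k → d ≡ 2 * k → k < h → HasCount (ReachIn h d v) (m ^ k)
  even-short k refl k<h = HasCount-cong (ShareAncestor⇔ReachIn k v) (count-ShareAncestor-< k<h)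
  even-long : ∀ k → d ≡ 2 * k → h ≤ k → HasCount (ReachIn h d v) ((m + 1) * m ^ (h ∸ 1))
  even-long k refl h≤k = subst (HasCount _) (cong (_* m ^ length js) (+-comm 1 m))
    (HasCount-cong (ShareAncestor⇔ReachIn k v) (count-ShareAncestor-≥ i js h≤k))
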